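{- Let $w\in\{a,b\}^*$ with $l(w)=8$. Then all elements of $\mathtt{BR}(w)$ are rich if and only if $w=abababab$.
   Context: The alphabet $\{a,b\}$ is unordered: $a$ and $b$ denote the two letters in either order (the statement is understood up to exchanging them). For a non-empty word, its run-length encoding is $c_1^{n_1}\cdots c_k^{n_k}$ with $c_i\ne c_{i+1}$, $n_i\ge1$; $l(w)=k$. $\mathtt{BR}(w)=\{B_t\cdots B_1 : w=B_1\cdots B_t,\ t\ge1,\ B_i \text{ non-empty}\}$. A word $w$ is rich if it has exactly $|w|$ distinct non-empty palindromic factors. -}

module Defs where

open import Data.Nat using (ℕ; zero; suc; _≤_)
open import Data.List using (List; []; _∷_; _++_; length; reverse; concat; filter; deduplicate; drop; take; upTo; map; concatMap; applyUpTo)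
open import Data.List.Properties using (≡-dec)
open import Data.List.Relation.Unary.All using (All)
open import Data.Product using (Σ; _×_; ∃)
open import Relation.Binary.PropositionalEquality using (_≡_; _≢_; refl)
open import Relation.Nullary using (Dec; yes; no; ¬_)
open import Relation.Binary using (DecidableEquality)

data Letter : Set where
  a b : Letter

_≟L_ : DecidableEquality Letter
a ≟L a = yes refl
a ≟L b = no λ ()
b ≟L a = no λ ()
b ≟L b = yes refl

Word : Set
Word = List Letter

_≟W_ : DecidableEquality Word
_≟W_ = ≡-dec _≟L_

-- number of runs l(w) in the run-length encoding (l [] = 0; only used for non-empty w)
runsFrom : Letter → Word → ℕ
runsFrom x [] = 1
runsFrom x (y ∷ ys) with x ≟L y
... | yes _ = runsFrom y ys
... | no _ = suc (runsFrom y ys)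

l : Word → ℕ
l [] = 0
l (x ∷ xs) = runsFrom x xs

-- all non-empty factors w[i..j) with i < j ≤ |w| (possibly with repetitions)
factors : Word → List Word
factors w = concatMap (λ i → applyUpTo (λ k → take (suc k) (drop i w)) (length w Data.Nat.∸ i)) (upTo (length w))

Palindrome : Word → Set
Palindrome u = reverse u ≡ u

palindrome? : (u : Word) → Dec (Palindrome u)
palindrome? u = reverse u ≟W u

distinctPalFactors : Word → List Word
distinctPalFactors w = deduplicate _≟W_ (filter palindrome? (factors w))

Rich : Word → Set
Rich w = length (distinctPalFactors w) ≡ length w

NonEmpty : Word → Set
NonEmpty u = u ≢ []

_∈BR_ : Word → Word → Set
u ∈BR w = Σ (List Word) λ Bs →
  (1 ≤ length Bs) × All NonEmpty Bs × (concat Bs ≡ w) × (u ≡ concat (reverse Bs))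

-- Prepending a letter creates at most one new palindromic factor (a new one must be the longest
-- palindromic prefix), so a word has at most |w| of them and richness passes to factors. A word
-- with 8 runs is therefore excluded once some block reversal of it has a non-rich factor. Such a
-- factor is exhibited for every run-length pattern other than 1⁸, the surplus of a long run being
-- kept inside a single block, so that one witness serves all run lengths. For (ab)⁴ and (ba)⁴
-- every block reversal is checked by evaluation.

module Submission where

open import Defs
open import Data.Bool using (Bool; true; false; T; _∧_)
open import Data.Bool.Properties using (T-∧)
open import Data.Empty using (⊥-elim)
open import Data.List
  using (List; []; _∷_; _++_; [_]; length; reverse; concat; filter; drop; take; map;
         replicate; upTo; applyUpTo)
open import Data.List.Properties
  using (length-++; length-drop; length-map; take++drop≡id; ++-assoc; ++-identityʳ; reverse-++;
         reverse-involutive; reverse-map; map-replicate; ∷-injective)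
open import Data.List.Membership.Propositional using (_∈_; _∉_; find; lose)
open import Data.List.Membership.Propositional.Properties
  using (∈-concatMap⁻; ∈-concatMap⁺; ∈-applyUpTo⁻; ∈-applyUpTo⁺; ∈-upTo⁺; ∈-filter⁺; ∈-filter⁻;
         ∈-deduplicate⁺; ∈-deduplicate⁻; ∈-∃++; ∈-++⁻; ∈-++⁺ˡ; ∈-++⁺ʳ; ∈-map⁺)
open import Data.List.Relation.Binary.Subset.Propositional using (_⊆_)
open import Data.List.Relation.Unary.All using (All; []; _∷_; all?; lookup)
open import Data.List.Relation.Unary.AllPairs using (_∷_)
open import Data.List.Relation.Unary.Any using (here; there; any?)
open import Data.List.Relation.Unary.Unique.Propositional using (Unique)
open import Data.List.Relation.Unary.Unique.DecPropositional.Properties _≟W_ using (deduplicate-!)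
open import Data.Nat using (ℕ; zero; suc; _+_; _∸_; _≤_; _<_; z≤n; s≤s; _≟_)
open import Data.Nat.Properties
  using (≤-refl; ≤-trans; ≤-antisym; ≤-reflexive; m+n∸m≡n; m≤m+n; m<m+n; +-suc; n≤1+n; +-identityʳ;
         +-comm; +-monoˡ-≤; +-monoʳ-≤; +-cancelˡ-≤; +-cancelʳ-≤; module ≤-Reasoning)
open import Data.Product using (∃; ∃₂; _×_; _,_; proj₂)
open import Data.Sum using (_⊎_; inj₁; inj₂)
open import Function using (_∘_; Equivalence)
open import Relation.Binary using (DecidableEquality)
open import Relation.Binary.PropositionalEquality
  using (_≡_; _≢_; refl; sym; trans; cong; cong₂; subst; module ≡-Reasoning)
open import Relation.Nullary using (Dec; yes; no; ¬_; ¬?)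
open import Relation.Nullary.Decidable using (True; False; toWitness; toWitnessFalse)

-- Palindromic factors and richness

Factor : Word → Word → Set
Factor u w = ∃₂ λ p s → w ≡ p ++ u ++ s

∈-factors⁻ : ∀ {u} w → u ∈ factors w → NonEmpty u × Factor u w
∈-factors⁻ w u∈ with i , _ , u∈ᵢ ← find (∈-concatMap⁻ _ {xs = upTo (length w)} u∈)
                 with k , k< , refl ← ∈-applyUpTo⁻ _ u∈ᵢ
  = nonEmpty (drop i w) (subst (0 <_) (sym (length-drop i w)) (≤-trans (s≤s z≤n) k<))
  , take i w , drop (suc k) (drop i w)
  , sym (trans (cong (take i w ++_) (take++drop≡id (suc k) (drop i w))) (take++drop≡id i w))
  where
  nonEmpty : ∀ xs → 0 < length xs → NonEmpty (take (suc k) xs)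
  nonEmpty (_ ∷ _) _ ()

∈-factors⁺ : ∀ {u} w → NonEmpty u → Factor u w → u ∈ factors w
∈-factors⁺ {[]} w ne _ = ⊥-elim (ne refl)
∈-factors⁺ {c ∷ u} .(p ++ (c ∷ u) ++ s) _ (p , s , refl) =
  ∈-concatMap⁺ _ {xs = upTo (length w)}
    (lose (∈-upTo⁺ p<w) (subst (_∈ applyUpTo slice (length w ∸ length p)) slice≡ (∈-applyUpTo⁺ slice u<)))
  where
  w = p ++ (c ∷ u) ++ s
  slice : ℕ → Word
  slice k = take (suc k) (drop (length p) w)
  length-w : length w ≡ length p + suc (length u + length s)
  length-w = trans (length-++ p) (cong (length p +_) (cong suc (length-++ u)))
  p<w : length p < length w
  p<w = subst (length p <_) (sym length-w) (m<m+n (length p) (s≤s z≤n))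
  u< : length u < length w ∸ length p
  u< = subst (length u <_) (sym (trans (cong (_∸ length p) length-w) (m+n∸m≡n (length p) _)))
         (s≤s (m≤m+n _ _))
  drop-prefix : ∀ (q r : Word) → drop (length q) (q ++ r) ≡ r
  drop-prefix []      r = refl
  drop-prefix (_ ∷ q) r = drop-prefix q r
  take-prefix : ∀ (q r : Word) → take (length q) (q ++ r) ≡ q
  take-prefix []      r = refl
  take-prefix (x ∷ q) r = cong (x ∷_) (take-prefix q r)
  slice≡ : take (suc (length u)) (drop (length p) w) ≡ c ∷ u
  slice≡ = trans (cong (take (suc (length u))) (drop-prefix p ((c ∷ u) ++ s))) (take-prefix (c ∷ u) s)

PalFactor : Word → Word → Set
PalFactor u w = Palindrome u × NonEmpty u × Factor u w

∈-distinctPalFactors⁻ : ∀ {u} w → u ∈ distinctPalFactors w → PalFactor u w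
∈-distinctPalFactors⁻ w u∈
  with u∈factors , pal ← ∈-filter⁻ palindrome? {xs = factors w} (∈-deduplicate⁻ _≟W_ _ u∈)
  with ne , fac ← ∈-factors⁻ w u∈factors
  = pal , ne , fac

∈-distinctPalFactors⁺ : ∀ {u} w → PalFactor u w → u ∈ distinctPalFactors w
∈-distinctPalFactors⁺ w (pal , ne , fac) = ∈-deduplicate⁺ _≟W_ (∈-filter⁺ palindrome? (∈-factors⁺ w ne fac) pal)

palCount : Word → ℕ
palCount w = length (distinctPalFactors w)

rich? : (w : Word) → Dec (Rich w)
rich? w = palCount w ≟ length w

module _ {A : Set} where

  length-mono-⊆ : {xs ys : List A} → Unique xs → xs ⊆ ys → length xs ≤ length ys
  length-mono-⊆ {[]}     _        _   = z≤n
  length-mono-⊆ {x ∷ xs} (x∉xs ∷ uniq) sub with ys₁ , ys₂ , refl ← ∈-∃++ (sub (here refl)) =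
    subst (suc (length xs) ≤_) (sym (trans (length-++ ys₁) (+-suc (length ys₁) (length ys₂))))
      (s≤s (subst (length xs ≤_) (length-++ ys₁) (length-mono-⊆ uniq sub′)))
    where
    sub′ : xs ⊆ ys₁ ++ ys₂
    sub′ {z} z∈xs with ∈-++⁻ ys₁ (sub (there z∈xs))
    ... | inj₁ z∈ys₁          = ∈-++⁺ˡ z∈ys₁
    ... | inj₂ (here refl)    = ⊥-elim (lookup x∉xs z∈xs refl)
    ... | inj₂ (there z∈ys₂)  = ∈-++⁺ʳ ys₁ z∈ys₂

module _ {A : Set} (_≟_ : DecidableEquality A) where

  open import Data.List.Membership.DecPropositional _≟_ using (_∈?_)

  length-≤-suc-if-one-outside : {xs ys : List A} → Unique xs →
    (∀ {u v} → u ∈ xs → v ∈ xs → u ∉ ys → v ∉ ys → u ≡ v) → length xs ≤ suc (length ys)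
  length-≤-suc-if-one-outside {xs} {ys} uniq oneOutside with any? (λ u → ¬? (u ∈? ys)) xs
  ... | yes outside with v , v∈xs , v∉ys ← find outside = length-mono-⊆ uniq sub
    where
    sub : xs ⊆ v ∷ ys
    sub {u} u∈xs with u ∈? ys
    ... | yes u∈ys = there u∈ys
    ... | no  u∉ys = here (oneOutside u∈xs v∈xs u∉ys v∉ys)
  ... | no noneOutside = ≤-trans (length-mono-⊆ uniq sub) (n≤1+n _)
    where
    sub : xs ⊆ ys
    sub {u} u∈xs with u ∈? ys
    ... | yes u∈ys = u∈ys
    ... | no  u∉ys = ⊥-elim (noneOutside (lose u∈xs u∉ys))

palCount-mono : ∀ v w → (∀ {u} → PalFactor u v → PalFactor u w) → palCount v ≤ palCount w
palCount-mono v w f =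
  length-mono-⊆ (deduplicate-! (filter palindrome? (factors v)))
    (∈-distinctPalFactors⁺ w ∘ f ∘ ∈-distinctPalFactors⁻ v)

Factor-reverse : ∀ {u w} → Factor u w → Factor (reverse u) (reverse w)
Factor-reverse {u} (p , s , refl) = reverse s , reverse p ,
  trans (reverse-++ p (u ++ s))
    (trans (cong (_++ reverse p) (reverse-++ u s)) (++-assoc (reverse s) (reverse u) (reverse p)))

PalFactor-reverse : ∀ {u w} → PalFactor u w → PalFactor u (reverse w)
PalFactor-reverse (pal , ne , fac) = pal , ne , subst (λ t → Factor t _) pal (Factor-reverse fac)

palCount-reverse : ∀ w → palCount (reverse w) ≡ palCount w
palCount-reverse w = ≤-antisym
  (palCount-mono (reverse w) w (subst (PalFactor _) (reverse-involutive w) ∘ PalFactor-reverse))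
  (palCount-mono w (reverse w) PalFactor-reverse)

prefixes-comparable : ∀ (q z s t : Word) → q ++ s ≡ z ++ t →
  (∃ λ r → z ≡ q ++ r) ⊎ (∃ λ r → q ≡ z ++ r)
prefixes-comparable []      z       _ _ _ = inj₁ (z , refl)
prefixes-comparable (c ∷ q) []      _ _ _ = inj₂ (c ∷ q , refl)
prefixes-comparable (c ∷ q) (d ∷ z) s t eq with refl , eq′ ← ∷-injective eq
  with prefixes-comparable q z s t eq′
... | inj₁ (r , refl) = inj₁ (r , refl)
... | inj₂ (r , refl) = inj₂ (r , refl)

new-PalFactor-is-prefix : ∀ {u x v} → PalFactor u (x ∷ v) → ¬ PalFactor u v → ∃ λ s → x ∷ v ≡ u ++ s
new-PalFactor-is-prefix (_ , _ , []    , s , eq) _   = s , eq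
new-PalFactor-is-prefix (pal , ne , _ ∷ p , s , eq) old = ⊥-elim (old (pal , ne , p , s , proj₂ (∷-injective eq)))

-- A palindrome z = q ++ r with palindromic q also ends with q, since z = reverse r ++ q.
palPrefix-of-palindrome-in-tail : ∀ {q r z x v s} → Palindrome z → z ≡ q ++ r → NonEmpty r →
  x ∷ v ≡ z ++ s → Palindrome q → NonEmpty q → PalFactor q v
palPrefix-of-palindrome-in-tail {q} {r} {z} {x} {v} {s} palz refl r≢[] eq palq q≢[] with reverse r in rev-r
... | []    = ⊥-elim (r≢[] (trans (sym (reverse-involutive r)) (cong reverse rev-r)))
... | d ∷ t = palq , q≢[] , t , s , proj₂ (∷-injective eq′)
  where
  z≡ : z ≡ (d ∷ t) ++ q
  z≡ = trans (sym palz) (trans (reverse-++ q r) (cong₂ _++_ rev-r palq))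
  eq′ : x ∷ v ≡ d ∷ (t ++ q ++ s)
  eq′ = trans eq (trans (cong (_++ s) z≡) (++-assoc (d ∷ t) q s))

new-PalFactor-unique : ∀ {u z x v} → PalFactor u (x ∷ v) → PalFactor z (x ∷ v) →
  ¬ PalFactor u v → ¬ PalFactor z v → u ≡ z
new-PalFactor-unique {u} {z} pu@(palu , u≢[] , _) pz@(palz , z≢[] , _) newu newz
  with s , eqᵤ ← new-PalFactor-is-prefix pu newu | t , eqz ← new-PalFactor-is-prefix pz newz
  with prefixes-comparable u z s t (trans (sym eqᵤ) eqz)
... | inj₁ ([]    , z≡) = sym (trans z≡ (++-identityʳ u))
... | inj₁ (_ ∷ _ , z≡) = ⊥-elim (newu (palPrefix-of-palindrome-in-tail palz z≡ (λ ()) eqz palu u≢[]))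
... | inj₂ ([]    , u≡) = trans u≡ (++-identityʳ z)
... | inj₂ (_ ∷ _ , u≡) = ⊥-elim (newz (palPrefix-of-palindrome-in-tail palu u≡ (λ ()) eqᵤ palz z≢[]))

palCount-∷ : ∀ x v → palCount (x ∷ v) ≤ suc (palCount v)
palCount-∷ x v = length-≤-suc-if-one-outside _≟W_ (deduplicate-! (filter palindrome? (factors (x ∷ v))))
  λ u∈ z∈ u∉ z∉ → new-PalFactor-unique
    (∈-distinctPalFactors⁻ (x ∷ v) u∈) (∈-distinctPalFactors⁻ (x ∷ v) z∈)
    (u∉ ∘ ∈-distinctPalFactors⁺ v) (z∉ ∘ ∈-distinctPalFactors⁺ v)

palCount-∷ʳ : ∀ v y → palCount (v ++ [ y ]) ≤ suc (palCount v)
palCount-∷ʳ v y = begin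
  palCount (v ++ [ y ])             ≡⟨ sym (palCount-reverse (v ++ [ y ])) ⟩
  palCount (reverse (v ++ [ y ]))   ≡⟨ cong palCount (reverse-++ v [ y ]) ⟩
  palCount (y ∷ reverse v)          ≤⟨ palCount-∷ y (reverse v) ⟩
  suc (palCount (reverse v))        ≡⟨ cong suc (palCount-reverse v) ⟩
  suc (palCount v)                  ∎
  where open ≤-Reasoning

palCount-++ˡ : ∀ p v → palCount (p ++ v) ≤ length p + palCount v
palCount-++ˡ []      v = ≤-refl
palCount-++ˡ (x ∷ p) v = ≤-trans (palCount-∷ x (p ++ v)) (s≤s (palCount-++ˡ p v))

palCount-++ʳ : ∀ v s → palCount (v ++ s) ≤ palCount v + length s
palCount-++ʳ v []      = ≤-reflexive (trans (cong palCount (++-identityʳ v)) (sym (+-identityʳ _)))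
palCount-++ʳ v (y ∷ s) = begin
  palCount (v ++ y ∷ s)                ≡⟨ cong palCount (sym (++-assoc v [ y ] s)) ⟩
  palCount ((v ++ [ y ]) ++ s)         ≤⟨ palCount-++ʳ (v ++ [ y ]) s ⟩
  palCount (v ++ [ y ]) + length s     ≤⟨ +-monoˡ-≤ (length s) (palCount-∷ʳ v y) ⟩
  suc (palCount v) + length s          ≡⟨ sym (+-suc (palCount v) (length s)) ⟩
  palCount v + length (y ∷ s)          ∎
  where open ≤-Reasoning

palCount≤length : ∀ w → palCount w ≤ length w
palCount≤length w = begin
  palCount w               ≡⟨ cong palCount (sym (++-identityʳ w)) ⟩
  palCount (w ++ [])       ≤⟨ palCount-++ˡ w [] ⟩
  length w + 0             ≡⟨ +-identityʳ (length w) ⟩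
  length w                 ∎
  where open ≤-Reasoning

Rich-factor : ∀ p v s → Rich (p ++ v ++ s) → Rich v
Rich-factor p v s rich = ≤-antisym (palCount≤length v)
  (+-cancelʳ-≤ (length s) (length v) (palCount v) (+-cancelˡ-≤ (length p) _ _ (begin
    length p + (length v + length s)   ≡⟨ sym (trans (length-++ p) (cong (length p +_) (length-++ v))) ⟩
    length (p ++ v ++ s)               ≡⟨ sym rich ⟩
    palCount (p ++ v ++ s)             ≤⟨ palCount-++ˡ p (v ++ s) ⟩
    length p + palCount (v ++ s)       ≤⟨ +-monoʳ-≤ (length p) (palCount-++ʳ v s) ⟩
    length p + (palCount v + length s) ∎)))
  where open ≤-Reasoning

-- Runs and block reversals

BR-rich : Word → Set
BR-rich w = ∀ u → u ∈BR w → Rich u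

other : Letter → Letter
other a = b
other b = a

other-involutive : ∀ x → other (other x) ≡ x
other-involutive a = refl
other-involutive b = refl

≢⇒≡other : ∀ {x y} → x ≢ y → y ≡ other x
≢⇒≡other {a} {a} x≢y = ⊥-elim (x≢y refl)
≢⇒≡other {a} {b} _   = refl
≢⇒≡other {b} {a} _   = refl
≢⇒≡other {b} {b} x≢y = ⊥-elim (x≢y refl)

≢other : ∀ x → x ≢ other x
≢other a ()
≢other b ()

runs : Letter → Letter → List ℕ → Word
runs x y []       = []
runs x y (n ∷ ns) = replicate n x ++ runs y x ns

runLengthEncoding : ∀ x ys → ∃ λ ms → runsFrom x ys ≡ length ms × x ∷ ys ≡ runs x (other x) (map suc ms)
runLengthEncoding x []       = 0 ∷ [] , refl , refl
runLengthEncoding x (y ∷ ys) with x ≟L y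
... | yes refl with runLengthEncoding x ys
...   | m ∷ ms , count≡ , ys≡ = suc m ∷ ms , count≡ , cong (x ∷_) ys≡
runLengthEncoding x (y ∷ ys) | no x≢y with runLengthEncoding y ys | ≢⇒≡other x≢y
... | ms , count≡ , ys≡ | refl =
  0 ∷ ms , cong suc count≡ ,
  cong (x ∷_) (trans ys≡ (cong (λ z → runs (other x) z (map suc ms)) (other-involutive x)))

runs-¬Rich : ∀ {x y} → x ≢ y → ∀ ns → {False (rich? (runs a b ns))} → {False (rich? (runs b a ns))} →
  ¬ Rich (runs x y ns)
runs-¬Rich {a} {a} a≢a _ = ⊥-elim (a≢a refl)
runs-¬Rich {a} {b} _   ns {¬rich} = toWitnessFalse ¬rich
runs-¬Rich {b} {a} _   ns {_} {¬rich} = toWitnessFalse ¬rich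
runs-¬Rich {b} {b} b≢b _ = ⊥-elim (b≢b refl)

-- A word in which some stretches of equal letters are kept opaque: only `letter` segments are
-- looked at when certifying a factor, so certificates work for arbitrary chunk lengths.
data Seg : Set where
  letter : Letter → Seg
  chunk  : Letter → ℕ → Seg

⟦_⟧ : List Seg → Word
⟦ [] ⟧              = []
⟦ letter x ∷ ss ⟧   = x ∷ ⟦ ss ⟧
⟦ chunk x k ∷ ss ⟧  = replicate k x ++ ⟦ ss ⟧

⟦++⟧ : ∀ ss tt → ⟦ ss ++ tt ⟧ ≡ ⟦ ss ⟧ ++ ⟦ tt ⟧
⟦++⟧ []               tt = refl
⟦++⟧ (letter x ∷ ss)  tt = cong (x ∷_) (⟦++⟧ ss tt)
⟦++⟧ (chunk x k ∷ ss) tt =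
  trans (cong (replicate k x ++_) (⟦++⟧ ss tt)) (sym (++-assoc (replicate k x) ⟦ ss ⟧ ⟦ tt ⟧))

⟦map-letter⟧ : ∀ v → ⟦ map letter v ⟧ ≡ v
⟦map-letter⟧ []      = refl
⟦map-letter⟧ (x ∷ v) = cong (x ∷_) (⟦map-letter⟧ v)

⟦concat⟧ : ∀ sss → concat (map ⟦_⟧ sss) ≡ ⟦ concat sss ⟧
⟦concat⟧ []         = refl
⟦concat⟧ (ss ∷ sss) = trans (cong (⟦ ss ⟧ ++_) (⟦concat⟧ sss)) (sym (⟦++⟧ ss (concat sss)))

replicate-+ : ∀ m n (x : Letter) → replicate (m + n) x ≡ replicate m x ++ replicate n x
replicate-+ zero    n x = refl
replicate-+ (suc m) n x = cong (x ∷_) (replicate-+ m n x)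

data RunLayout : Set where
  one     : RunLayout
  ⟨_∣_∣_⟩ : (h k t : ℕ) → RunLayout

-- Summed in this order so that e.g. runLength ⟨ 2 ∣ m ∣ 0 ⟩ and runLength ⟨ 0 ∣ m ∣ 2 ⟩ reduce to suc (suc m).
runLength : RunLayout → ℕ
runLength one           = 1
runLength ⟨ h ∣ k ∣ t ⟩ = h + (t + k)

layoutSegs : Letter → RunLayout → List Seg
layoutSegs x one           = letter x ∷ []
layoutSegs x ⟨ h ∣ k ∣ t ⟩ = replicate h (letter x) ++ chunk x k ∷ replicate t (letter x)

⟦layoutSegs⟧ : ∀ x r → ⟦ layoutSegs x r ⟧ ≡ replicate (runLength r) x
⟦layoutSegs⟧ x one           = refl
⟦layoutSegs⟧ x ⟨ h ∣ k ∣ t ⟩ = begin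
  ⟦ replicate h (letter x) ++ chunk x k ∷ replicate t (letter x) ⟧
    ≡⟨ ⟦++⟧ (replicate h (letter x)) _ ⟩
  ⟦ replicate h (letter x) ⟧ ++ replicate k x ++ ⟦ replicate t (letter x) ⟧
    ≡⟨ cong₂ (λ u v → u ++ replicate k x ++ v) (⟦rep⟧ h) (⟦rep⟧ t) ⟩
  replicate h x ++ replicate k x ++ replicate t x
    ≡⟨ cong (replicate h x ++_) (sym (replicate-+ k t x)) ⟩
  replicate h x ++ replicate (k + t) x
    ≡⟨ cong (λ n → replicate h x ++ replicate n x) (+-comm k t) ⟩
  replicate h x ++ replicate (t + k) x
    ≡⟨ sym (replicate-+ h (t + k) x) ⟩
  replicate (h + (t + k)) x ∎
  where
  open ≡-Reasoning
  ⟦rep⟧ : ∀ n → ⟦ replicate n (letter x) ⟧ ≡ replicate n x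
  ⟦rep⟧ n = trans (cong ⟦_⟧ (sym (map-replicate letter n x))) (⟦map-letter⟧ (replicate n x))

runsSegs : Letter → Letter → List RunLayout → List Seg
runsSegs x y []       = []
runsSegs x y (r ∷ rs) = layoutSegs x r ++ runsSegs y x rs

⟦runsSegs⟧ : ∀ x y rs → ⟦ runsSegs x y rs ⟧ ≡ runs x y (map runLength rs)
⟦runsSegs⟧ x y []       = refl
⟦runsSegs⟧ x y (r ∷ rs) =
  trans (⟦++⟧ (layoutSegs x r) (runsSegs y x rs)) (cong₂ _++_ (⟦layoutSegs⟧ x r) (⟦runsSegs⟧ y x rs))

chop : List ℕ → List Seg → List (List Seg)
chop []       ss = ss ∷ []
chop (n ∷ ns) ss = take n ss ∷ chop ns (drop n ss)

concat-chop : ∀ ns ss → concat (chop ns ss) ≡ ss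
concat-chop []       ss = ++-identityʳ ss
concat-chop (n ∷ ns) ss = trans (cong (take n ss ++_) (concat-chop ns (drop n ss))) (take++drop≡id n ss)

1≤length-chop : ∀ ns ss → 1 ≤ length (chop ns ss)
1≤length-chop []      _ = s≤s z≤n
1≤length-chop (_ ∷ _) _ = s≤s z≤n

hasLetter : List Seg → Bool
hasLetter []               = false
hasLetter (letter _ ∷ _)   = true
hasLetter (chunk _ _ ∷ ss) = hasLetter ss

NonEmpty-⟦⟧ : ∀ ss → T (hasLetter ss) → NonEmpty ⟦ ss ⟧
NonEmpty-⟦⟧ (letter x ∷ ss) _ ()
NonEmpty-⟦⟧ (chunk x zero ∷ ss) h = NonEmpty-⟦⟧ ss h
NonEmpty-⟦⟧ (chunk x (suc k) ∷ ss) _ ()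

allHaveLetter : List (List Seg) → Bool
allHaveLetter []         = true
allHaveLetter (ss ∷ sss) = hasLetter ss ∧ allHaveLetter sss

All-NonEmpty-⟦⟧ : ∀ sss → T (allHaveLetter sss) → All NonEmpty (map ⟦_⟧ sss)
All-NonEmpty-⟦⟧ []         _ = []
All-NonEmpty-⟦⟧ (ss ∷ sss) h with h₁ , h₂ ← Equivalence.to T-∧ h =
  NonEmpty-⟦⟧ ss h₁ ∷ All-NonEmpty-⟦⟧ sss h₂

chop-∈BR : ∀ ns ss → T (allHaveLetter (chop ns ss)) → ⟦ concat (reverse (chop ns ss)) ⟧ ∈BR ⟦ ss ⟧
chop-∈BR ns ss h =
  map ⟦_⟧ sss ,
  subst (1 ≤_) (sym (length-map ⟦_⟧ sss)) (1≤length-chop ns ss) ,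
  All-NonEmpty-⟦⟧ sss h ,
  trans (⟦concat⟧ sss) (cong ⟦_⟧ (concat-chop ns ss)) ,
  sym (trans (cong concat (sym (reverse-map ⟦_⟧ sss))) (⟦concat⟧ (reverse sss)))
  where sss = chop ns ss

window-Factor : ∀ p v ss → take (length v) (drop p ss) ≡ map letter v → Factor v ⟦ ss ⟧
window-Factor p v ss window = ⟦ take p ss ⟧ , ⟦ rest ⟧ , (begin
  ⟦ ss ⟧
    ≡⟨ cong ⟦_⟧ (sym (take++drop≡id p ss)) ⟩
  ⟦ take p ss ++ drop p ss ⟧
    ≡⟨ ⟦++⟧ (take p ss) (drop p ss) ⟩
  ⟦ take p ss ⟧ ++ ⟦ drop p ss ⟧
    ≡⟨ cong (λ t → ⟦ take p ss ⟧ ++ ⟦ t ⟧) (sym (take++drop≡id (length v) (drop p ss))) ⟩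
  ⟦ take p ss ⟧ ++ ⟦ shown ++ rest ⟧
    ≡⟨ cong (⟦ take p ss ⟧ ++_) (⟦++⟧ shown rest) ⟩
  ⟦ take p ss ⟧ ++ ⟦ shown ⟧ ++ ⟦ rest ⟧
    ≡⟨ cong (λ t → ⟦ take p ss ⟧ ++ t ++ ⟦ rest ⟧) (trans (cong ⟦_⟧ window) (⟦map-letter⟧ v)) ⟩
  ⟦ take p ss ⟧ ++ v ++ ⟦ rest ⟧ ∎)
  where
  open ≡-Reasoning
  shown = take (length v) (drop p ss)
  rest  = drop (length v) (drop p ss)

-- A certificate that BR(runs x y (map runLength rs)) contains a non-rich word: a chopping bs of the
-- layout into blocks, each showing a letter, whose reversal shows the non-rich runs z z′ ns at offset p.
not-all-BR-rich : ∀ {x y} rs bs p {z z′} → z ≢ z′ → ∀ ns →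
  {_ : False (rich? (runs a b ns))} {_ : False (rich? (runs b a ns))} →
  {_ : T (allHaveLetter (chop bs (runsSegs x y rs)))} →
  take (length (runs z z′ ns)) (drop p (concat (reverse (chop bs (runsSegs x y rs))))) ≡ map letter (runs z z′ ns) →
  ¬ BR-rich (runs x y (map runLength rs))
not-all-BR-rich {x} {y} rs bs p {z} {z′} z≢z′ ns {¬rich₁} {¬rich₂} {h} window allRich =
  let q , s , u≡ = window-Factor p v (concat (reverse blocks)) window
  in runs-¬Rich z≢z′ ns {¬rich₁} {¬rich₂} (Rich-factor q v s (subst Rich u≡ (allRich _ u∈BR)))
  where
  v = runs z z′ ns
  blocks = chop bs (runsSegs x y rs)
  u∈BR : ⟦ concat (reverse blocks) ⟧ ∈BR runs x y (map runLength rs)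
  u∈BR = subst (⟦ concat (reverse blocks) ⟧ ∈BR_) (⟦runsSegs⟧ x y rs) (chop-∈BR bs (runsSegs x y rs) h)

-- Words with eight runs

-- Certificates for not-all-BR-rich, found by computer search.
all-runs-single : ∀ {x y} → x ≢ y → ∀ m1 m2 m3 m4 m5 m6 m7 m8 →
  BR-rich (runs x y (map suc (m1 ∷ m2 ∷ m3 ∷ m4 ∷ m5 ∷ m6 ∷ m7 ∷ m8 ∷ []))) →
  m1 ∷ m2 ∷ m3 ∷ m4 ∷ m5 ∷ m6 ∷ m7 ∷ m8 ∷ [] ≡ replicate 8 0
all-runs-single x≢y 0 0 0 0 0 0 0 0 _ = refl
all-runs-single x≢y 0 0 0 0 0 0 0 (suc m8) allRich = ⊥-elim (not-all-BR-rich
  (one ∷ one ∷ one ∷ one ∷ one ∷ one ∷ one ∷ ⟨ 0 ∣ m8 ∣ 2 ⟩ ∷ [])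
  (1 ∷ 1 ∷ 2 ∷ 3 ∷ []) 1 (x≢y ∘ sym) (2 ∷ 1 ∷ 1 ∷ 2 ∷ 2 ∷ []) refl allRich)
all-runs-single x≢y 0 0 0 0 0 0 (suc m7) m8 allRich = ⊥-elim (not-all-BR-rich
  (one ∷ one ∷ one ∷ one ∷ one ∷ one ∷ ⟨ 0 ∣ m7 ∣ 2 ⟩ ∷ ⟨ 0 ∣ m8 ∣ 1 ⟩ ∷ [])
  (1 ∷ 2 ∷ 3 ∷ 3 ∷ []) 3 x≢y (2 ∷ 1 ∷ 1 ∷ 2 ∷ 2 ∷ []) refl allRich)
all-runs-single x≢y 0 0 0 0 0 (suc m6) 0 0 allRich = ⊥-elim (not-all-BR-rich
  (one ∷ one ∷ one ∷ one ∷ one ∷ ⟨ 0 ∣ m6 ∣ 2 ⟩ ∷ one ∷ one ∷ [])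
  (1 ∷ 1 ∷ 2 ∷ 1 ∷ []) 1 (x≢y ∘ sym) (2 ∷ 1 ∷ 1 ∷ 2 ∷ 2 ∷ []) refl allRich)
all-runs-single x≢y 0 0 0 0 0 (suc m6) 0 (suc m8) allRich = ⊥-elim (not-all-BR-rich
  (one ∷ one ∷ one ∷ one ∷ one ∷ ⟨ 1 ∣ m6 ∣ 1 ⟩ ∷ one ∷ ⟨ 1 ∣ m8 ∣ 1 ⟩ ∷ [])
  (4 ∷ 1 ∷ 1 ∷ 4 ∷ []) 3 (x≢y ∘ sym) (1 ∷ 1 ∷ 2 ∷ 2 ∷ 1 ∷ 1 ∷ 1 ∷ []) refl allRich)
all-runs-single x≢y 0 0 0 0 0 (suc m6) (suc m7) m8 allRich = ⊥-elim (not-all-BR-rich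
  (one ∷ one ∷ one ∷ one ∷ one ∷ ⟨ 0 ∣ m6 ∣ 2 ⟩ ∷ ⟨ 2 ∣ m7 ∣ 0 ⟩ ∷ ⟨ 0 ∣ m8 ∣ 1 ⟩ ∷ [])
  (6 ∷ 3 ∷ 1 ∷ []) 2 (x≢y ∘ sym) (1 ∷ 1 ∷ 2 ∷ 2 ∷ 1 ∷ 1 ∷ 1 ∷ []) refl allRich)
all-runs-single x≢y 0 0 0 0 (suc m5) 0 m7 m8 allRich = ⊥-elim (not-all-BR-rich
  (one ∷ one ∷ one ∷ one ∷ ⟨ 0 ∣ m5 ∣ 2 ⟩ ∷ one ∷ ⟨ 1 ∣ m7 ∣ 0 ⟩ ∷ ⟨ 0 ∣ m8 ∣ 1 ⟩ ∷ [])
  (1 ∷ 2 ∷ 1 ∷ 5 ∷ []) 4 x≢y (2 ∷ 1 ∷ 1 ∷ 2 ∷ 2 ∷ []) refl allRich)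
all-runs-single x≢y 0 0 0 0 (suc m5) (suc m6) m7 m8 allRich = ⊥-elim (not-all-BR-rich
  (one ∷ one ∷ one ∷ one ∷ ⟨ 0 ∣ m5 ∣ 2 ⟩ ∷ ⟨ 2 ∣ m6 ∣ 0 ⟩ ∷ ⟨ 0 ∣ m7 ∣ 1 ⟩ ∷ ⟨ 0 ∣ m8 ∣ 1 ⟩ ∷ [])
  (5 ∷ 1 ∷ 3 ∷ []) 4 (x≢y ∘ sym) (1 ∷ 1 ∷ 2 ∷ 2 ∷ 1 ∷ 1 ∷ 1 ∷ []) refl allRich)
all-runs-single x≢y 0 0 0 (suc m4) m5 m6 m7 m8 allRich = ⊥-elim (not-all-BR-rich
  (one ∷ one ∷ one ∷ ⟨ 2 ∣ m4 ∣ 0 ⟩ ∷ ⟨ 0 ∣ m5 ∣ 1 ⟩ ∷ ⟨ 0 ∣ m6 ∣ 1 ⟩ ∷ ⟨ 1 ∣ m7 ∣ 0 ⟩ ∷ ⟨ 0 ∣ m8 ∣ 1 ⟩ ∷ [])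
  (9 ∷ 2 ∷ []) 2 (x≢y ∘ sym) (2 ∷ 2 ∷ 1 ∷ 1 ∷ 2 ∷ []) refl allRich)
all-runs-single x≢y 0 0 (suc m3) 0 0 m6 m7 m8 allRich = ⊥-elim (not-all-BR-rich
  (one ∷ one ∷ ⟨ 2 ∣ m3 ∣ 0 ⟩ ∷ one ∷ one ∷ ⟨ 1 ∣ m6 ∣ 0 ⟩ ∷ ⟨ 0 ∣ m7 ∣ 1 ⟩ ∷ ⟨ 0 ∣ m8 ∣ 1 ⟩ ∷ [])
  (5 ∷ 1 ∷ 2 ∷ 3 ∷ []) 4 x≢y (2 ∷ 2 ∷ 1 ∷ 1 ∷ 2 ∷ []) refl allRich)
all-runs-single x≢y 0 0 (suc m3) 0 (suc m5) m6 m7 m8 allRich = ⊥-elim (not-all-BR-rich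
  (one ∷ one ∷ ⟨ 2 ∣ m3 ∣ 0 ⟩ ∷ one ∷ ⟨ 0 ∣ m5 ∣ 2 ⟩ ∷ ⟨ 1 ∣ m6 ∣ 0 ⟩ ∷ ⟨ 0 ∣ m7 ∣ 1 ⟩ ∷ ⟨ 0 ∣ m8 ∣ 1 ⟩ ∷ [])
  (5 ∷ 1 ∷ 4 ∷ []) 6 x≢y (2 ∷ 2 ∷ 1 ∷ 1 ∷ 2 ∷ []) refl allRich)
all-runs-single x≢y 0 0 (suc m3) (suc m4) m5 m6 m7 m8 allRich = ⊥-elim (not-all-BR-rich
  (one ∷ one ∷ ⟨ 2 ∣ m3 ∣ 0 ⟩ ∷ ⟨ 0 ∣ m4 ∣ 2 ⟩ ∷ ⟨ 1 ∣ m5 ∣ 0 ⟩ ∷ ⟨ 0 ∣ m6 ∣ 1 ⟩ ∷ ⟨ 0 ∣ m7 ∣ 1 ⟩ ∷ ⟨ 0 ∣ m8 ∣ 1 ⟩ ∷ [])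
  (6 ∷ 2 ∷ 1 ∷ 5 ∷ []) 6 x≢y (2 ∷ 2 ∷ 1 ∷ 1 ∷ 2 ∷ []) refl allRich)
all-runs-single x≢y 0 (suc m2) 0 0 0 m6 m7 m8 allRich = ⊥-elim (not-all-BR-rich
  (one ∷ ⟨ 2 ∣ m2 ∣ 0 ⟩ ∷ one ∷ one ∷ one ∷ ⟨ 1 ∣ m6 ∣ 0 ⟩ ∷ ⟨ 0 ∣ m7 ∣ 1 ⟩ ∷ ⟨ 0 ∣ m8 ∣ 1 ⟩ ∷ [])
  (4 ∷ 1 ∷ 3 ∷ []) 4 (x≢y ∘ sym) (2 ∷ 1 ∷ 1 ∷ 2 ∷ 2 ∷ []) refl allRich)
all-runs-single x≢y 0 (suc m2) 0 0 (suc m5) m6 m7 m8 allRich = ⊥-elim (not-all-BR-rich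
  (one ∷ ⟨ 0 ∣ m2 ∣ 2 ⟩ ∷ one ∷ one ∷ ⟨ 2 ∣ m5 ∣ 0 ⟩ ∷ ⟨ 0 ∣ m6 ∣ 1 ⟩ ∷ ⟨ 0 ∣ m7 ∣ 1 ⟩ ∷ ⟨ 0 ∣ m8 ∣ 1 ⟩ ∷ [])
  (2 ∷ 5 ∷ 1 ∷ 5 ∷ []) 6 x≢y (2 ∷ 2 ∷ 1 ∷ 1 ∷ 2 ∷ []) refl allRich)
all-runs-single x≢y 0 (suc m2) 0 (suc m4) 0 m6 m7 m8 allRich = ⊥-elim (not-all-BR-rich
  (one ∷ ⟨ 2 ∣ m2 ∣ 0 ⟩ ∷ one ∷ ⟨ 0 ∣ m4 ∣ 2 ⟩ ∷ one ∷ ⟨ 1 ∣ m6 ∣ 0 ⟩ ∷ ⟨ 0 ∣ m7 ∣ 1 ⟩ ∷ ⟨ 0 ∣ m8 ∣ 1 ⟩ ∷ [])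
  (4 ∷ 1 ∷ 5 ∷ []) 6 (x≢y ∘ sym) (2 ∷ 1 ∷ 1 ∷ 2 ∷ 2 ∷ []) refl allRich)
all-runs-single x≢y 0 (suc m2) 0 (suc m4) (suc m5) m6 m7 m8 allRich = ⊥-elim (not-all-BR-rich
  (one ∷ ⟨ 0 ∣ m2 ∣ 2 ⟩ ∷ one ∷ ⟨ 1 ∣ m4 ∣ 1 ⟩ ∷ ⟨ 2 ∣ m5 ∣ 0 ⟩ ∷ ⟨ 0 ∣ m6 ∣ 1 ⟩ ∷ ⟨ 1 ∣ m7 ∣ 0 ⟩ ∷ ⟨ 0 ∣ m8 ∣ 1 ⟩ ∷ [])
  (2 ∷ 5 ∷ 3 ∷ 4 ∷ []) 5 (x≢y ∘ sym) (1 ∷ 1 ∷ 1 ∷ 2 ∷ 2 ∷ 1 ∷ 1 ∷ []) refl allRich)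
all-runs-single x≢y 0 (suc m2) (suc m3) 0 0 m6 m7 m8 allRich = ⊥-elim (not-all-BR-rich
  (one ∷ ⟨ 0 ∣ m2 ∣ 2 ⟩ ∷ ⟨ 0 ∣ m3 ∣ 2 ⟩ ∷ one ∷ one ∷ ⟨ 1 ∣ m6 ∣ 0 ⟩ ∷ ⟨ 0 ∣ m7 ∣ 1 ⟩ ∷ ⟨ 0 ∣ m8 ∣ 1 ⟩ ∷ [])
  (2 ∷ 3 ∷ 2 ∷ 3 ∷ []) 4 (x≢y ∘ sym) (2 ∷ 1 ∷ 1 ∷ 2 ∷ 2 ∷ []) refl allRich)
all-runs-single x≢y 0 (suc m2) (suc m3) 0 (suc m5) m6 m7 m8 allRich = ⊥-elim (not-all-BR-rich
  (one ∷ ⟨ 0 ∣ m2 ∣ 2 ⟩ ∷ ⟨ 2 ∣ m3 ∣ 0 ⟩ ∷ one ∷ ⟨ 0 ∣ m5 ∣ 2 ⟩ ∷ ⟨ 1 ∣ m6 ∣ 0 ⟩ ∷ ⟨ 0 ∣ m7 ∣ 1 ⟩ ∷ ⟨ 0 ∣ m8 ∣ 1 ⟩ ∷ [])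
  (2 ∷ 3 ∷ 1 ∷ 6 ∷ []) 8 x≢y (2 ∷ 1 ∷ 1 ∷ 2 ∷ 2 ∷ []) refl allRich)
all-runs-single x≢y 0 (suc m2) (suc m3) (suc m4) m5 m6 m7 m8 allRich = ⊥-elim (not-all-BR-rich
  (one ∷ ⟨ 2 ∣ m2 ∣ 0 ⟩ ∷ ⟨ 0 ∣ m3 ∣ 2 ⟩ ∷ ⟨ 2 ∣ m4 ∣ 0 ⟩ ∷ ⟨ 0 ∣ m5 ∣ 1 ⟩ ∷ ⟨ 0 ∣ m6 ∣ 1 ⟩ ∷ ⟨ 0 ∣ m7 ∣ 1 ⟩ ∷ ⟨ 0 ∣ m8 ∣ 1 ⟩ ∷ [])
  (5 ∷ 3 ∷ 1 ∷ []) 8 (x≢y ∘ sym) (2 ∷ 2 ∷ 1 ∷ 1 ∷ 2 ∷ []) refl allRich)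
all-runs-single x≢y (suc m1) 0 0 0 0 m6 m7 m8 allRich = ⊥-elim (not-all-BR-rich
  (⟨ 2 ∣ m1 ∣ 0 ⟩ ∷ one ∷ one ∷ one ∷ one ∷ ⟨ 1 ∣ m6 ∣ 0 ⟩ ∷ ⟨ 0 ∣ m7 ∣ 1 ⟩ ∷ ⟨ 0 ∣ m8 ∣ 1 ⟩ ∷ [])
  (3 ∷ 1 ∷ 4 ∷ 3 ∷ []) 4 x≢y (2 ∷ 1 ∷ 1 ∷ 2 ∷ 2 ∷ []) refl allRich)
all-runs-single x≢y (suc m1) 0 0 0 (suc m5) m6 m7 m8 allRich = ⊥-elim (not-all-BR-rich
  (⟨ 1 ∣ m1 ∣ 1 ⟩ ∷ one ∷ one ∷ one ∷ ⟨ 0 ∣ m5 ∣ 2 ⟩ ∷ ⟨ 1 ∣ m6 ∣ 0 ⟩ ∷ ⟨ 0 ∣ m7 ∣ 1 ⟩ ∷ ⟨ 0 ∣ m8 ∣ 1 ⟩ ∷ [])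
  (2 ∷ 1 ∷ 3 ∷ 4 ∷ []) 6 x≢y (2 ∷ 2 ∷ 1 ∷ 1 ∷ 2 ∷ []) refl allRich)
all-runs-single x≢y (suc m1) 0 0 (suc m4) m5 m6 m7 m8 allRich = ⊥-elim (not-all-BR-rich
  (⟨ 0 ∣ m1 ∣ 2 ⟩ ∷ one ∷ one ∷ ⟨ 2 ∣ m4 ∣ 0 ⟩ ∷ ⟨ 0 ∣ m5 ∣ 1 ⟩ ∷ ⟨ 0 ∣ m6 ∣ 1 ⟩ ∷ ⟨ 1 ∣ m7 ∣ 0 ⟩ ∷ ⟨ 0 ∣ m8 ∣ 1 ⟩ ∷ [])
  (2 ∷ 9 ∷ 2 ∷ []) 2 (x≢y ∘ sym) (2 ∷ 2 ∷ 1 ∷ 1 ∷ 2 ∷ []) refl allRich)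
all-runs-single x≢y (suc m1) 0 (suc m3) 0 0 m6 m7 m8 allRich = ⊥-elim (not-all-BR-rich
  (⟨ 1 ∣ m1 ∣ 1 ⟩ ∷ one ∷ ⟨ 0 ∣ m3 ∣ 2 ⟩ ∷ one ∷ one ∷ ⟨ 1 ∣ m6 ∣ 0 ⟩ ∷ ⟨ 0 ∣ m7 ∣ 1 ⟩ ∷ ⟨ 0 ∣ m8 ∣ 1 ⟩ ∷ [])
  (2 ∷ 1 ∷ 1 ∷ 6 ∷ []) 6 x≢y (2 ∷ 1 ∷ 1 ∷ 2 ∷ 2 ∷ []) refl allRich)
all-runs-single x≢y (suc m1) 0 (suc m3) 0 (suc m5) m6 m7 m8 allRich = ⊥-elim (not-all-BR-rich
  (⟨ 0 ∣ m1 ∣ 2 ⟩ ∷ one ∷ ⟨ 2 ∣ m3 ∣ 0 ⟩ ∷ one ∷ ⟨ 0 ∣ m5 ∣ 2 ⟩ ∷ ⟨ 1 ∣ m6 ∣ 0 ⟩ ∷ ⟨ 0 ∣ m7 ∣ 1 ⟩ ∷ ⟨ 0 ∣ m8 ∣ 1 ⟩ ∷ [])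
  (2 ∷ 5 ∷ 1 ∷ 4 ∷ []) 6 x≢y (2 ∷ 2 ∷ 1 ∷ 1 ∷ 2 ∷ []) refl allRich)
all-runs-single x≢y (suc m1) 0 (suc m3) (suc m4) 0 0 m7 m8 allRich = ⊥-elim (not-all-BR-rich
  (⟨ 0 ∣ m1 ∣ 2 ⟩ ∷ one ∷ ⟨ 1 ∣ m3 ∣ 1 ⟩ ∷ ⟨ 2 ∣ m4 ∣ 0 ⟩ ∷ one ∷ one ∷ ⟨ 1 ∣ m7 ∣ 0 ⟩ ∷ ⟨ 0 ∣ m8 ∣ 1 ⟩ ∷ [])
  (2 ∷ 4 ∷ 3 ∷ 4 ∷ []) 4 x≢y (1 ∷ 1 ∷ 2 ∷ 2 ∷ 1 ∷ 1 ∷ 1 ∷ []) refl allRich)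
all-runs-single x≢y (suc m1) 0 (suc m3) (suc m4) 0 (suc m6) m7 m8 allRich = ⊥-elim (not-all-BR-rich
  (⟨ 0 ∣ m1 ∣ 2 ⟩ ∷ one ∷ ⟨ 0 ∣ m3 ∣ 2 ⟩ ∷ ⟨ 1 ∣ m4 ∣ 1 ⟩ ∷ one ∷ ⟨ 2 ∣ m6 ∣ 0 ⟩ ∷ ⟨ 0 ∣ m7 ∣ 1 ⟩ ∷ ⟨ 0 ∣ m8 ∣ 1 ⟩ ∷ [])
  (2 ∷ 3 ∷ 3 ∷ 5 ∷ []) 6 (x≢y ∘ sym) (1 ∷ 1 ∷ 2 ∷ 2 ∷ 1 ∷ 1 ∷ 1 ∷ []) refl allRich)
all-runs-single x≢y (suc m1) 0 (suc m3) (suc m4) (suc m5) m6 m7 m8 allRich = ⊥-elim (not-all-BR-rich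
  (⟨ 0 ∣ m1 ∣ 2 ⟩ ∷ one ∷ ⟨ 2 ∣ m3 ∣ 0 ⟩ ∷ ⟨ 0 ∣ m4 ∣ 2 ⟩ ∷ ⟨ 0 ∣ m5 ∣ 2 ⟩ ∷ ⟨ 0 ∣ m6 ∣ 1 ⟩ ∷ ⟨ 0 ∣ m7 ∣ 1 ⟩ ∷ ⟨ 0 ∣ m8 ∣ 1 ⟩ ∷ [])
  (2 ∷ 6 ∷ 2 ∷ 3 ∷ []) 7 x≢y (2 ∷ 2 ∷ 1 ∷ 1 ∷ 2 ∷ []) refl allRich)
all-runs-single x≢y (suc m1) (suc m2) 0 0 m5 m6 m7 m8 allRich = ⊥-elim (not-all-BR-rich
  (⟨ 2 ∣ m1 ∣ 0 ⟩ ∷ ⟨ 0 ∣ m2 ∣ 2 ⟩ ∷ one ∷ one ∷ ⟨ 1 ∣ m5 ∣ 0 ⟩ ∷ ⟨ 0 ∣ m6 ∣ 1 ⟩ ∷ ⟨ 0 ∣ m7 ∣ 1 ⟩ ∷ ⟨ 0 ∣ m8 ∣ 1 ⟩ ∷ [])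
  (4 ∷ 2 ∷ 3 ∷ 5 ∷ []) 6 x≢y (2 ∷ 1 ∷ 1 ∷ 2 ∷ 2 ∷ []) refl allRich)
all-runs-single x≢y (suc m1) (suc m2) 0 (suc m4) 0 m6 m7 m8 allRich = ⊥-elim (not-all-BR-rich
  (⟨ 0 ∣ m1 ∣ 2 ⟩ ∷ ⟨ 2 ∣ m2 ∣ 0 ⟩ ∷ one ∷ ⟨ 0 ∣ m4 ∣ 2 ⟩ ∷ one ∷ ⟨ 1 ∣ m6 ∣ 0 ⟩ ∷ ⟨ 0 ∣ m7 ∣ 1 ⟩ ∷ ⟨ 0 ∣ m8 ∣ 1 ⟩ ∷ [])
  (2 ∷ 4 ∷ 1 ∷ 5 ∷ []) 6 (x≢y ∘ sym) (2 ∷ 1 ∷ 1 ∷ 2 ∷ 2 ∷ []) refl allRich)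
all-runs-single x≢y (suc m1) (suc m2) 0 (suc m4) (suc m5) m6 m7 m8 allRich = ⊥-elim (not-all-BR-rich
  (⟨ 0 ∣ m1 ∣ 2 ⟩ ∷ ⟨ 0 ∣ m2 ∣ 2 ⟩ ∷ one ∷ ⟨ 1 ∣ m4 ∣ 1 ⟩ ∷ ⟨ 2 ∣ m5 ∣ 0 ⟩ ∷ ⟨ 0 ∣ m6 ∣ 1 ⟩ ∷ ⟨ 1 ∣ m7 ∣ 0 ⟩ ∷ ⟨ 0 ∣ m8 ∣ 1 ⟩ ∷ [])
  (4 ∷ 5 ∷ 3 ∷ 4 ∷ []) 5 (x≢y ∘ sym) (1 ∷ 1 ∷ 1 ∷ 2 ∷ 2 ∷ 1 ∷ 1 ∷ []) refl allRich)
all-runs-single x≢y (suc m1) (suc m2) (suc m3) 0 m5 m6 m7 m8 allRich = ⊥-elim (not-all-BR-rich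
  (⟨ 1 ∣ m1 ∣ 1 ⟩ ∷ ⟨ 2 ∣ m2 ∣ 0 ⟩ ∷ ⟨ 0 ∣ m3 ∣ 2 ⟩ ∷ one ∷ ⟨ 1 ∣ m5 ∣ 0 ⟩ ∷ ⟨ 0 ∣ m6 ∣ 1 ⟩ ∷ ⟨ 0 ∣ m7 ∣ 1 ⟩ ∷ ⟨ 0 ∣ m8 ∣ 1 ⟩ ∷ [])
  (2 ∷ 1 ∷ 2 ∷ 6 ∷ []) 9 x≢y (2 ∷ 1 ∷ 1 ∷ 2 ∷ 2 ∷ []) refl allRich)
all-runs-single x≢y (suc m1) (suc m2) (suc m3) (suc m4) m5 m6 m7 m8 allRich = ⊥-elim (not-all-BR-rich
  (⟨ 0 ∣ m1 ∣ 2 ⟩ ∷ ⟨ 2 ∣ m2 ∣ 0 ⟩ ∷ ⟨ 0 ∣ m3 ∣ 2 ⟩ ∷ ⟨ 2 ∣ m4 ∣ 0 ⟩ ∷ ⟨ 0 ∣ m5 ∣ 1 ⟩ ∷ ⟨ 0 ∣ m6 ∣ 1 ⟩ ∷ ⟨ 0 ∣ m7 ∣ 1 ⟩ ∷ ⟨ 0 ∣ m8 ∣ 1 ⟩ ∷ [])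
  (2 ∷ 5 ∷ 3 ∷ 1 ∷ []) 8 (x≢y ∘ sym) (2 ∷ 2 ∷ 1 ∷ 1 ∷ 2 ∷ []) refl allRich)

BR-rich-8-runs : ∀ {x y} → x ≢ y → ∀ ms → length ms ≡ 8 → BR-rich (runs x y (map suc ms)) → ms ≡ replicate 8 0
BR-rich-8-runs x≢y (m1 ∷ m2 ∷ m3 ∷ m4 ∷ m5 ∷ m6 ∷ m7 ∷ m8 ∷ []) refl = all-runs-single x≢y m1 m2 m3 m4 m5 m6 m7 m8
BR-rich-8-runs _ []                                        ()
BR-rich-8-runs _ (_ ∷ [])                                  ()
BR-rich-8-runs _ (_ ∷ _ ∷ [])                              ()
BR-rich-8-runs _ (_ ∷ _ ∷ _ ∷ [])                          ()
BR-rich-8-runs _ (_ ∷ _ ∷ _ ∷ _ ∷ [])                      ()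
BR-rich-8-runs _ (_ ∷ _ ∷ _ ∷ _ ∷ _ ∷ [])                  ()
BR-rich-8-runs _ (_ ∷ _ ∷ _ ∷ _ ∷ _ ∷ _ ∷ [])              ()
BR-rich-8-runs _ (_ ∷ _ ∷ _ ∷ _ ∷ _ ∷ _ ∷ _ ∷ [])          ()
BR-rich-8-runs _ (_ ∷ _ ∷ _ ∷ _ ∷ _ ∷ _ ∷ _ ∷ _ ∷ _ ∷ _)  ()

factorizations : Word → List (List Word)
factorizations []       = [] ∷ []
factorizations (x ∷ xs) = map ([ x ] ∷_) (factorizations xs) ++ map extendHead (factorizations xs)
  where
  extendHead : List Word → List Word
  extendHead []       = [ x ] ∷ []
  extendHead (B ∷ Bs) = (x ∷ B) ∷ Bs

factorizations-complete : ∀ w Bs → All NonEmpty Bs → concat Bs ≡ w → Bs ∈ factorizations w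
factorizations-complete []       []                  _          _  = here refl
factorizations-complete []       ([] ∷ _)            (ne ∷ _)   _  = ⊥-elim (ne refl)
factorizations-complete (x ∷ xs) ([] ∷ _)            (ne ∷ _)   _  = ⊥-elim (ne refl)
factorizations-complete (x ∷ xs) ((c ∷ []) ∷ Bs)     (_ ∷ nes)  eq with refl , eq′ ← ∷-injective eq =
  ∈-++⁺ˡ (∈-map⁺ ([ x ] ∷_) (factorizations-complete xs Bs nes eq′))
factorizations-complete (x ∷ xs) ((c ∷ d ∷ B) ∷ Bs) (_ ∷ nes)  eq with refl , eq′ ← ∷-injective eq =
  ∈-++⁺ʳ _ (∈-map⁺ _ (factorizations-complete xs ((d ∷ B) ∷ Bs) ((λ ()) ∷ nes) eq′))

BR-rich-if-factorizations-rich : ∀ w → All (Rich ∘ concat ∘ reverse) (factorizations w) → BR-rich w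
BR-rich-if-factorizations-rich w allRich u (Bs , _ , nes , concat≡ , refl) =
  lookup allRich (factorizations-complete w Bs nes concat≡)

BR-rich-by-evaluation : ∀ w → {_ : True (all? (rich? ∘ concat ∘ reverse) (factorizations w))} → BR-rich w
BR-rich-by-evaluation w {allRich} = BR-rich-if-factorizations-rich w (toWitness allRich)

Alternating : Word → Set
Alternating w = w ≡ a ∷ b ∷ a ∷ b ∷ a ∷ b ∷ a ∷ b ∷ [] ⊎ w ≡ b ∷ a ∷ b ∷ a ∷ b ∷ a ∷ b ∷ a ∷ []

Alternating⇒BR-rich : ∀ {w} → Alternating w → BR-rich w
Alternating⇒BR-rich (inj₁ refl) = BR-rich-by-evaluation _
Alternating⇒BR-rich (inj₂ refl) = BR-rich-by-evaluation _

BR-rich⇒Alternating : ∀ w → l w ≡ 8 → BR-rich w → Alternating w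
BR-rich⇒Alternating (x ∷ ys) l≡8 allRich
  with ms , l≡ , w≡ ← runLengthEncoding x ys
  with refl ← BR-rich-8-runs (≢other x) ms (trans (sym l≡) l≡8) (subst BR-rich w≡ allRich)
  = subst Alternating (sym w≡) (single-runs x)
  where
  single-runs : ∀ x → Alternating (runs x (other x) (map suc (replicate 8 0)))
  single-runs a = inj₁ refl
  single-runs b = inj₂ refl

proposition4p11 : (w : Word) → l w ≡ 8 →
    ((∀ u → u ∈BR w → Rich u) → (w ≡ a ∷ b ∷ a ∷ b ∷ a ∷ b ∷ a ∷ b ∷ [] ⊎ w ≡ b ∷ a ∷ b ∷ a ∷ b ∷ a ∷ b ∷ a ∷ []))
    × ((w ≡ a ∷ b ∷ a ∷ b ∷ a ∷ b ∷ a ∷ b ∷ [] ⊎ w ≡ b ∷ a ∷ b ∷ a ∷ b ∷ a ∷ b ∷ a ∷ []) → (∀ u → u ∈BR w → Rich u))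
proposition4p11 w l≡8 = BR-rich⇒Alternating w l≡8 , Alternating⇒BR-rich
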